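{- Let $r,k\ge1$ be integers and let $G$ be a graph. Then \[m_e(G\square S_k,r)\le m_e(G,r)+k\,m_e(G,r-1)+\sum_{t=1}^{k-1}t\,d^G_{r-t}+k\sum_{t=k}^{r}d^G_{r-t}.\]
   Context: All graphs are finite and simple; $S_k$ is the star with $k$ leaves and $\square$ the Cartesian product. For a graph $G$ and integer $r\ge0$, the $r$-bond bootstrap percolation process on $G$ starts from a set $S\subseteq E(G)$ of infected edges; at each step a healthy edge becomes infected if at least one of its endpoints is incident with at least $r$ infected edges, and infected edges stay infected. $S$ is $r$-percolating if it eventually infects all of $E(G)$; $m_e(G,r)$ is the minimum size of an $r$-percolating set. $d^G_t$ is the number of vertices of $G$ of degree $t$ (zero when $t<0$). -}

module Defs where

open import Data.Nat using (ℕ; zero; suc; _+_; _*_; _∸_; _<ᵇ_; _≤ᵇ_; _≡ᵇ_)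
open import Data.Bool using (Bool; true; false; _∧_; _∨_; if_then_else_)
open import Data.Bool.Properties using (∧-zeroʳ)
open import Data.Fin using (Fin; zero; suc; toℕ; remQuot)
open import Data.Product using (_×_; _,_; proj₁; proj₂; ∃)
open import Data.List using (List; map; upTo)
open import Data.Nat.ListAction using (sum)
open import Function using (_∘_)
open import Relation.Binary.PropositionalEquality using (_≡_; refl; cong₂)

record Graph (n : ℕ) : Set where
  field
    adj    : Fin n → Fin n → Bool
    sym    : ∀ u v → adj u v ≡ adj v u
    irrefl : ∀ u → adj u u ≡ false
open Graph public

feq : ∀ {n} → Fin n → Fin n → Bool
feq zero    zero    = true
feq zero    (suc _) = false
feq (suc _) zero    = false
feq (suc a) (suc b) = feq a b

feq-sym : ∀ {n} (a b : Fin n) → feq a b ≡ feq b a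
feq-sym zero    zero    = refl
feq-sym zero    (suc _) = refl
feq-sym (suc _) zero    = refl
feq-sym (suc a) (suc b) = feq-sym a b

feq-refl : ∀ {n} (a : Fin n) → feq a a ≡ true
feq-refl zero    = refl
feq-refl (suc a) = feq-refl a

starAdj : ∀ {k} → Fin (suc k) → Fin (suc k) → Bool
starAdj zero    zero    = false
starAdj zero    (suc _) = true
starAdj (suc _) zero    = true
starAdj (suc _) (suc _) = false

starSym : ∀ {k} (u v : Fin (suc k)) → starAdj u v ≡ starAdj v u
starSym zero    zero    = refl
starSym zero    (suc _) = refl
starSym (suc _) zero    = refl
starSym (suc _) (suc _) = refl

starIrr : ∀ {k} (u : Fin (suc k)) → starAdj u u ≡ false
starIrr zero    = refl
starIrr (suc _) = refl

Star : (k : ℕ) → Graph (suc k)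
Star k = record { adj = starAdj ; sym = starSym ; irrefl = starIrr }

-- Cartesian product G □ H on vertex set Fin (n * m), a vertex x
-- corresponding to the pair remQuot m x : Fin n × Fin m.
pairAdj : ∀ {n m} → Graph n → Graph m → Fin n × Fin m → Fin n × Fin m → Bool
pairAdj G H (a , b) (c , d) = (adj G a c ∧ feq b d) ∨ (feq a c ∧ adj H b d)

pairSym : ∀ {n m} (G : Graph n) (H : Graph m) (p q : Fin n × Fin m) →
          pairAdj G H p q ≡ pairAdj G H q p
pairSym G H (a , b) (c , d) =
  cong₂ _∨_ (cong₂ _∧_ (sym G a c) (feq-sym b d))
            (cong₂ _∧_ (feq-sym a c) (sym H b d))

pairIrr : ∀ {n m} (G : Graph n) (H : Graph m) (p : Fin n × Fin m) →
          pairAdj G H p p ≡ false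
pairIrr G H (a , b) rewrite irrefl G a | feq-refl a | irrefl H b = refl

prodAdj : ∀ {n m} → Graph n → Graph m → Fin (n * m) → Fin (n * m) → Bool
prodAdj {n} {m} G H x y = pairAdj G H (remQuot {n} m x) (remQuot {n} m y)

prodSym : ∀ {n m} (G : Graph n) (H : Graph m) (x y : Fin (n * m)) →
          prodAdj G H x y ≡ prodAdj G H y x
prodSym {n} {m} G H x y = pairSym G H (remQuot {n} m x) (remQuot {n} m y)

prodIrr : ∀ {n m} (G : Graph n) (H : Graph m) (x : Fin (n * m)) →
          prodAdj G H x x ≡ false
prodIrr {n} {m} G H x = pairIrr G H (remQuot {n} m x)

_□_ : ∀ {n m} → Graph n → Graph m → Graph (n * m)
G □ H = record { adj = prodAdj G H ; sym = prodSym G H ; irrefl = prodIrr G H }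

bit : Bool → ℕ
bit true  = 1
bit false = 0

countFin : ∀ {n} → (Fin n → Bool) → ℕ
countFin {zero}  p = 0
countFin {suc n} p = bit (p zero) + countFin (p ∘ suc)

sumFin : ∀ {n} → (Fin n → ℕ) → ℕ
sumFin {zero}  f = 0
sumFin {suc n} f = f zero + sumFin (f ∘ suc)

deg : ∀ {n} → Graph n → Fin n → ℕ
deg G v = countFin (adj G v)

d : ∀ {n} → Graph n → ℕ → ℕ
d G t = countFin (λ v → deg G v ≡ᵇ t)

-- d^G_{r-t}, which is zero when r - t < 0
dDiff : ∀ {n} → Graph n → ℕ → ℕ → ℕ
dDiff G r t = if t ≤ᵇ r then d G (r ∸ t) else 0

-- Σ_{t=a}^{b} f t  (empty when b < a)
sumFromTo : ℕ → ℕ → (ℕ → ℕ) → ℕ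
sumFromTo a b f = sum (map (λ i → f (a + i)) (upTo (suc b ∸ a)))

-- Edge sets.  A set of edges is given by S : Fin n → Fin n → Bool,
-- where only the entries S u v with toℕ u < toℕ v and adj u v matter:
-- the unordered pair {u,v} (u ≠ v) is read via ⟦ S ⟧.

EdgeSet : ℕ → Set
EdgeSet n = Fin n → Fin n → Bool

⟦_⟧ : ∀ {n} → EdgeSet n → Fin n → Fin n → Bool
⟦ S ⟧ u v = if toℕ u <ᵇ toℕ v then S u v else S v u

size : ∀ {n} → Graph n → EdgeSet n → ℕ
size G S = sumFin (λ u → countFin (λ v →
             (toℕ u <ᵇ toℕ v) ∧ (adj G u v ∧ S u v)))

infDeg : ∀ {n} → Graph n → EdgeSet n → Fin n → ℕ
infDeg G S v = countFin (λ u → adj G v u ∧ ⟦ S ⟧ v u)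

step : ∀ {n} → Graph n → ℕ → EdgeSet n → EdgeSet n
step G r S u v = ⟦ S ⟧ u v ∨
  (adj G u v ∧ ((r ≤ᵇ infDeg G S u) ∨ (r ≤ᵇ infDeg G S v)))

iter : ∀ {n} → Graph n → ℕ → ℕ → EdgeSet n → EdgeSet n
iter G r zero    S = S
iter G r (suc t) S = step G r (iter G r t S)

Percolating : ∀ {n} → Graph n → ℕ → EdgeSet n → Set
Percolating G r S =
  ∃ λ t → ∀ u v → adj G u v ≡ true → ⟦ iter G r t S ⟧ u v ≡ true

IsMe : ∀ {n} → Graph n → ℕ → ℕ → Set
IsMe G r m =
  (∃ λ S → Percolating G r S × size G S ≡ m) ×
  (∀ S → Percolating G r S → m Data.Nat.≤ size G S)

-- Infect a minimum r-percolating set S₁ of G in the centre copy of G, a minimum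
-- (r ∸ 1)-percolating set S₀ in each of the k leaf copies, and, at every vertex a, the
-- star edges from (a , 0) to the first min (r ∸ deg a) k leaves. The centre copy
-- percolates as G does. Then (a , 0) sees deg a + (r ∸ deg a) ≥ r infected edges unless
-- all of its star edges were seeded, so every star edge gets infected. Now each vertex of
-- a leaf copy has an infected edge leaving its copy, so threshold r ∸ 1 inside the copy
-- suffices and S₀ percolates there. By the handshake lemma applied to the infected
-- degrees, the seed has |S₁| + k |S₀| + Σₐ min (r ∸ deg a) k edges, and grouping the
-- vertices by t = r ∸ deg a turns the last sum into the two degree sums of the bound.

module Submission where

open import Defs hiding (sym)
open import Data.Nat
  using (ℕ; zero; suc; _+_; _*_; _∸_; _≤_; _<_; _⊓_; _<ᵇ_; _≤ᵇ_; _≡ᵇ_; z≤n; s≤s; _≤?_; _<?_)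
open import Data.Nat.Properties
open import Data.Bool using (Bool; true; false; _∧_; _∨_)
open import Data.Bool.Properties using (T-≡; ∨-comm)
open import Data.Fin using (Fin; zero; suc; toℕ; remQuot; combine; _↑ˡ_; _↑ʳ_)
open import Data.Fin.Properties using (toℕ-injective; toℕ<n; remQuot-combine; combine-remQuot)
open import Data.Product using (_×_; _,_; proj₁; proj₂)
open import Data.Sum as Sum using (_⊎_; inj₁; inj₂)
open import Function using (_∘_)
open import Data.List using (_∷_; []; map; upTo)
open import Data.List.Properties using (map-cong)
open import Data.List.Membership.Propositional using (_∈_)
open import Data.List.Membership.Propositional.Properties using (∈-upTo⁺)
open import Data.List.Relation.Unary.Any using (here; there)
open import Data.Nat.ListAction using (sum)
open import Data.Nat.Tactic.RingSolver using (solve-∀)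
open import Function.Bundles using (Equivalence)
open import Relation.Binary.Definitions using (tri<; tri≈; tri>)
open import Relation.Binary.PropositionalEquality
open import Relation.Nullary using (¬_; contradiction; yes; no)
open import Relation.Nullary.Reflects using (ofʸ)
open import Algebra.Properties.Semiring.Sum +-*-semiring
  using (sum-syntax; sum-cong-≗; sum-replicate-zero; ∑-distrib-+; ∑-comm; *-distribˡ-sum)
  renaming (sum to ∑)

∨-true : ∀ x {y} → x ∨ y ≡ true → x ≡ true ⊎ y ≡ true
∨-true true  _ = inj₁ refl
∨-true false p = inj₂ p

∧-true : ∀ x {y} → x ∧ y ≡ true → x ≡ true × y ≡ true
∧-true true  p = refl , p

∧-intro : ∀ {x y} → x ≡ true → y ≡ true → x ∧ y ≡ true
∧-intro refl p = p

≤ᵇ-intro : ∀ {m n} → m ≤ n → (m ≤ᵇ n) ≡ true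
≤ᵇ-intro = Equivalence.to T-≡ ∘ ≤⇒≤ᵇ

≤ᵇ-elim : ∀ {m n} → (m ≤ᵇ n) ≡ true → m ≤ n
≤ᵇ-elim = ≤ᵇ⇒≤ _ _ ∘ Equivalence.from T-≡

<ᵇ-intro : ∀ {m n} → m < n → (m <ᵇ n) ≡ true
<ᵇ-intro = Equivalence.to T-≡ ∘ <⇒<ᵇ

<ᵇ-false : ∀ {m n} → ¬ m < n → (m <ᵇ n) ≡ false
<ᵇ-false {m} {n} m≮n with m <ᵇ n | <ᵇ-reflects-< m n
... | true  | ofʸ m<n = contradiction m<n m≮n
... | false | _       = refl

<ᵇ-false-elim : ∀ {m n} → (m <ᵇ n) ≡ false → n ≤ m
<ᵇ-false-elim m≮ᵇn = ≮⇒≥ (λ m<n → contradiction (trans (sym (<ᵇ-intro m<n)) m≮ᵇn) λ ())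

feq-sound : ∀ {n} {a b : Fin n} → feq a b ≡ true → a ≡ b
feq-sound {a = zero}  {zero}  _ = refl
feq-sound {a = suc a} {suc b} p = cong suc (feq-sound p)

toℕ-<ᵇ-trichotomy : ∀ {n} (u v : Fin n) →
  ((toℕ u <ᵇ toℕ v) ≡ true × (toℕ v <ᵇ toℕ u) ≡ false) ⊎
  ((toℕ u <ᵇ toℕ v) ≡ false × (toℕ v <ᵇ toℕ u) ≡ true) ⊎ u ≡ v
toℕ-<ᵇ-trichotomy u v with <-cmp (toℕ u) (toℕ v)
... | tri< u<v _ v≮u = inj₁ (<ᵇ-intro u<v , <ᵇ-false v≮u)
... | tri> u≮v _ v<u = inj₂ (inj₁ (<ᵇ-false u≮v , <ᵇ-intro v<u))
... | tri≈ _ u≡v _   = inj₂ (inj₂ (toℕ-injective u≡v))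

bit-mono : ∀ {x y} → (x ≡ true → y ≡ true) → bit x ≤ bit y
bit-mono {false} _ = z≤n
bit-mono {true}  f rewrite f refl = ≤-refl

-- Splits the neighbourhood of a vertex of G □ K along the two disjuncts of pairAdj.
bit-pairAdj : ∀ x p q y z → (p ≡ true → q ≡ true → x ≡ false) →
  bit ((x ∧ p ∨ q ∧ y) ∧ z) ≡ bit (p ∧ (x ∧ z)) + bit (q ∧ (y ∧ z))
bit-pairAdj true  true  true  y z h with () ← h refl refl
bit-pairAdj true  true  false y z _ = sym (+-identityʳ (bit z))
bit-pairAdj true  false true  y z _ = refl
bit-pairAdj true  false false y z _ = refl
bit-pairAdj false true  true  y z _ = refl
bit-pairAdj false true  false y z _ = refl
bit-pairAdj false false true  y z _ = refl
bit-pairAdj false false false y z _ = refl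

sumFin≡∑ : ∀ {n} (f : Fin n → ℕ) → sumFin f ≡ ∑ f
sumFin≡∑ {zero}  f = refl
sumFin≡∑ {suc n} f = cong (f zero +_) (sumFin≡∑ (f ∘ suc))

countFin≡∑ : ∀ {n} (p : Fin n → Bool) → countFin p ≡ ∑ (bit ∘ p)
countFin≡∑ {zero}  p = refl
countFin≡∑ {suc n} p = cong (bit (p zero) +_) (countFin≡∑ (p ∘ suc))

∑-mono-≤ : ∀ {n} {f g : Fin n → ℕ} → (∀ i → f i ≤ g i) → ∑ f ≤ ∑ g
∑-mono-≤ {zero}  _ = z≤n
∑-mono-≤ {suc n} h = +-mono-≤ (h zero) (∑-mono-≤ (h ∘ suc))

∑-const : ∀ n c → ∑ {n} (λ _ → c) ≡ n * c
∑-const zero    c = refl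
∑-const (suc n) c = cong (c +_) (∑-const n c)

∑-↑ : ∀ m p (f : Fin (m + p) → ℕ) → ∑ f ≡ (∑[ i < m ] f (i ↑ˡ p)) + (∑[ j < p ] f (m ↑ʳ j))
∑-↑ zero    p f = refl
∑-↑ (suc m) p f = trans (cong (f zero +_) (∑-↑ m p (f ∘ suc))) (sym (+-assoc (f zero) _ _))

∑-combine : ∀ n m (f : Fin (n * m) → ℕ) → ∑ f ≡ ∑[ a < n ] ∑[ i < m ] f (combine a i)
∑-combine zero    m f = refl
∑-combine (suc n) m f =
  trans (∑-↑ m (n * m) f) (cong (∑[ i < m ] f (i ↑ˡ (n * m)) +_) (∑-combine n m (f ∘ (m ↑ʳ_))))

countFin-mono : ∀ {n} {p q : Fin n → Bool} →
  (∀ i → p i ≡ true → q i ≡ true) → countFin p ≤ countFin q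
countFin-mono {zero}  _ = z≤n
countFin-mono {suc n} h = +-mono-≤ (bit-mono (h zero)) (countFin-mono (h ∘ suc))

countFin-false : ∀ n → countFin {n} (λ _ → false) ≡ 0
countFin-false zero    = refl
countFin-false (suc n) = countFin-false n

countFin-toℕ<ᵇ : ∀ k m → countFin {k} (λ j → toℕ j <ᵇ m) ≡ m ⊓ k
countFin-toℕ<ᵇ zero    m       = sym (⊓-zeroʳ m)
countFin-toℕ<ᵇ (suc k) zero    = countFin-false k
countFin-toℕ<ᵇ (suc k) (suc m) = cong suc (countFin-toℕ<ᵇ k m)

∑-feq : ∀ {n} (i : Fin n) (w : Fin n → Bool) → ∑ (λ l → bit (feq i l ∧ w l)) ≡ bit (w i)
∑-feq {suc n} zero    w = trans (cong (bit (w zero) +_) (sum-replicate-zero n)) (+-identityʳ _)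
∑-feq {suc n} (suc i) w = ∑-feq i (w ∘ suc)

∀-combine : ∀ {n m} {P : Fin (n * m) → Fin (n * m) → Set} →
  (∀ a i c l → P (combine {n} {m} a i) (combine c l)) → ∀ u v → P u v
∀-combine {n} {m} {P} h u v =
  subst₂ P (combine-remQuot {n} m u) (combine-remQuot {n} m v) (h a i c l)
  where
  a = proj₁ (remQuot {n} m u); i = proj₂ (remQuot {n} m u)
  c = proj₁ (remQuot {n} m v); l = proj₂ (remQuot {n} m v)

⟦⟧-sym : ∀ {n} (S : EdgeSet n) u v → ⟦ S ⟧ u v ≡ ⟦ S ⟧ v u
⟦⟧-sym S u v with toℕ-<ᵇ-trichotomy u v
... | inj₁ (e₁ , e₂)        rewrite e₁ | e₂ = refl
... | inj₂ (inj₁ (e₁ , e₂)) rewrite e₁ | e₂ = refl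
... | inj₂ (inj₂ refl)      = refl

⟦⟧-of-symmetric : ∀ {n} (S : EdgeSet n) → (∀ u v → S u v ≡ S v u) →
  ∀ u v → ⟦ S ⟧ u v ≡ S u v
⟦⟧-of-symmetric S S-sym u v with toℕ u <ᵇ toℕ v
... | true  = refl
... | false = S-sym v u

⟦step⟧ : ∀ {n} (G : Graph n) r S u v → ⟦ step G r S ⟧ u v ≡ step G r S u v
⟦step⟧ G r S = ⟦⟧-of-symmetric (step G r S) λ u v →
  cong₂ _∨_ (⟦⟧-sym S u v)
            (cong₂ _∧_ (Graph.sym G u v) (∨-comm (r ≤ᵇ infDeg G S u) (r ≤ᵇ infDeg G S v)))

infix 4 _⊆_
_⊆_ : ∀ {n} → EdgeSet n → EdgeSet n → Set
S ⊆ T = ∀ u v → ⟦ S ⟧ u v ≡ true → ⟦ T ⟧ u v ≡ true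

⊆-trans : ∀ {n} {S T U : EdgeSet n} → S ⊆ T → T ⊆ U → S ⊆ U
⊆-trans S⊆T T⊆U u v = T⊆U u v ∘ S⊆T u v

⊆-step : ∀ {n} (G : Graph n) r S → S ⊆ step G r S
⊆-step G r S u v h rewrite ⟦step⟧ G r S u v | h = refl

⊆-iter : ∀ {n} (G : Graph n) r t S → S ⊆ iter G r t S
⊆-iter G r zero    S = λ _ _ h → h
⊆-iter G r (suc t) S = ⊆-trans (⊆-iter G r t S) (⊆-step G r (iter G r t S))

iter-+ : ∀ {n} (G : Graph n) r s t S → iter G r s (iter G r t S) ≡ iter G r (s + t) S
iter-+ G r zero    t S = refl
iter-+ G r (suc s) t S = cong (step G r) (iter-+ G r s t S)

step-intro : ∀ {n} (G : Graph n) r S u v → adj G u v ≡ true →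
  r ≤ infDeg G S u ⊎ r ≤ infDeg G S v → ⟦ step G r S ⟧ u v ≡ true
step-intro G r S u v e active rewrite ⟦step⟧ G r S u v | e with ⟦ S ⟧ u v
... | true  = refl
... | false with active
...   | inj₁ r≤u rewrite ≤ᵇ-intro r≤u = refl
...   | inj₂ r≤v rewrite ≤ᵇ-intro r≤v | ∨-comm (r ≤ᵇ infDeg G S u) true = refl

step-elim : ∀ {n} (G : Graph n) r S u v → ⟦ step G r S ⟧ u v ≡ true →
  ⟦ S ⟧ u v ≡ true ⊎ (adj G u v ≡ true × (r ≤ infDeg G S u ⊎ r ≤ infDeg G S v))
step-elim G r S u v h with ∨-true (⟦ S ⟧ u v) (trans (sym (⟦step⟧ G r S u v)) h)
... | inj₁ old = inj₁ old
... | inj₂ new with ∧-true (adj G u v) new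
...   | e , active with ∨-true (r ≤ᵇ infDeg G S u) active
...     | inj₁ r≤u = inj₂ (e , inj₁ (≤ᵇ-elim r≤u))
...     | inj₂ r≤v = inj₂ (e , inj₂ (≤ᵇ-elim r≤v))

countFin-cong : ∀ {n} {p q : Fin n → Bool} → (∀ i → p i ≡ q i) → countFin p ≡ countFin q
countFin-cong {zero}  _ = refl
countFin-cong {suc n} h = cong₂ _+_ (cong bit (h zero)) (countFin-cong (h ∘ suc))

-- An edge {u , v} is seen from both of its ends, and is counted by size from the smaller one.
incidences : ∀ {n} (G : Graph n) S u v →
  bit (adj G u v ∧ ⟦ S ⟧ u v) ≡
    bit ((toℕ u <ᵇ toℕ v) ∧ (adj G u v ∧ S u v)) +
    bit ((toℕ v <ᵇ toℕ u) ∧ (adj G v u ∧ S v u))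
incidences G S u v with toℕ-<ᵇ-trichotomy u v
... | inj₁ (e₁ , e₂)        rewrite e₁ | e₂ = sym (+-identityʳ _)
... | inj₂ (inj₁ (e₁ , e₂)) rewrite e₁ | e₂ | Graph.sym G u v = refl
... | inj₂ (inj₂ refl)      rewrite irrefl G u | <ᵇ-false (n≮n (toℕ u)) = refl

handshake : ∀ {n} (G : Graph n) S → ∑ (infDeg G S) ≡ 2 * size G S
handshake {n} G S = begin
  ∑ (infDeg G S)
    ≡⟨ sum-cong-≗ (λ u → trans (countFin≡∑ (λ v → adj G u v ∧ ⟦ S ⟧ u v))
                                (sum-cong-≗ (incidences G S u))) ⟩
  ∑[ u < n ] ∑[ v < n ] (e u v + e v u)
    ≡⟨ trans (sum-cong-≗ (λ u → ∑-distrib-+ (e u) (λ v → e v u)))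
             (∑-distrib-+ (λ u → ∑[ v < n ] e u v) (λ u → ∑[ v < n ] e v u)) ⟩
  (∑[ u < n ] ∑[ v < n ] e u v) + (∑[ u < n ] ∑[ v < n ] e v u)
    ≡⟨ cong ((∑[ u < n ] ∑[ v < n ] e u v) +_)
            (trans (∑-comm (λ u v → e v u)) (sym (+-identityʳ _))) ⟩
  2 * ∑[ u < n ] ∑[ v < n ] e u v
    ≡⟨ cong (2 *_) (sym (trans (sumFin≡∑ (countFin ∘ lowerEnd))
                               (sum-cong-≗ (countFin≡∑ ∘ lowerEnd)))) ⟩
  2 * size G S ∎
  where
  open ≡-Reasoning
  lowerEnd : Fin n → Fin n → Bool
  lowerEnd u v = (toℕ u <ᵇ toℕ v) ∧ (adj G u v ∧ S u v)
  e : Fin n → Fin n → ℕ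
  e u v = bit (lowerEnd u v)

-- Simulating a graph inside a copy of it

infix 4 _⊑⟨_⟩_
_⊑⟨_⟩_ : ∀ {n N} → EdgeSet n → (Fin n → Fin N) → EdgeSet N → Set
Y ⊑⟨ f ⟩ X = ∀ a c → ⟦ Y ⟧ a c ≡ true → ⟦ X ⟧ (f a) (f c) ≡ true

module _ {n N} {G : Graph n} {H : Graph N} {r′ r : ℕ} (f : Fin n → Fin N)
         (f-adj : ∀ {a c} → adj G a c ≡ true → adj H (f a) (f c) ≡ true) where

  step-⊑ : ∀ {Y X} → (∀ a → r′ ≤ infDeg G Y a → r ≤ infDeg H X (f a)) →
    Y ⊑⟨ f ⟩ X → step G r′ Y ⊑⟨ f ⟩ step H r X
  step-⊑ {Y} {X} active Y⊑X a c h with step-elim G r′ Y a c h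
  ... | inj₁ old         = ⊆-step H r X (f a) (f c) (Y⊑X a c old)
  ... | inj₂ (e , fires) = step-intro H r X (f a) (f c) (f-adj e) (Sum.map (active a) (active c) fires)

  simulate : ∀ {Y₀ X₀} →
    (∀ s {Y} → Y ⊑⟨ f ⟩ iter H r s X₀ →
       ∀ a → r′ ≤ infDeg G Y a → r ≤ infDeg H (iter H r s X₀) (f a)) →
    Y₀ ⊑⟨ f ⟩ X₀ → ∀ s → iter G r′ s Y₀ ⊑⟨ f ⟩ iter H r s X₀
  simulate active Y₀⊑X₀ zero    = Y₀⊑X₀
  simulate {X₀ = X₀} active Y₀⊑X₀ (suc s) = step-⊑ {X = iter H r s X₀} (active s Yₛ⊑Xₛ) Yₛ⊑Xₛ
    where Yₛ⊑Xₛ = simulate active Y₀⊑X₀ s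

module _ {n m} (G : Graph n) (K : Graph m) where

  adj-□ : ∀ a i c l → adj (G □ K) (combine a i) (combine c l) ≡ pairAdj G K (a , i) (c , l)
  adj-□ a i c l = cong₂ (pairAdj G K) (remQuot-combine a i) (remQuot-combine c l)

  adj-□-layer : ∀ i {a c} → adj G a c ≡ true → adj (G □ K) (combine a i) (combine c i) ≡ true
  adj-□-layer i {a} {c} e rewrite adj-□ a i c i | e | feq-refl i = refl

  adj-□-fibre : ∀ a {i l} → adj K i l ≡ true → adj (G □ K) (combine a i) (combine a l) ≡ true
  adj-□-fibre a {i} {l} e rewrite adj-□ a i a l | irrefl G a | feq-refl a | e = refl

  adj-□-elim : ∀ a i c l → adj (G □ K) (combine a i) (combine c l) ≡ true →
    (adj G a c ≡ true × i ≡ l) ⊎ (a ≡ c × adj K i l ≡ true)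
  adj-□-elim a i c l e with ∨-true (adj G a c ∧ feq i l) (trans (sym (adj-□ a i c l)) e)
  ... | inj₁ layer with ∧-true (adj G a c) layer
  ...   | ac , il = inj₁ (ac , feq-sound il)
  adj-□-elim a i c l e | inj₂ fibre with ∧-true (feq a c) fibre
  ...   | ac , il = inj₂ (feq-sound ac , il)

  infDeg-□ : ∀ X a i →
    infDeg (G □ K) X (combine a i) ≡
      countFin (λ c → adj G a c ∧ ⟦ X ⟧ (combine a i) (combine c i)) +
      countFin (λ l → adj K i l ∧ ⟦ X ⟧ (combine a i) (combine a l))
  infDeg-□ X a i = begin
    infDeg (G □ K) X (combine a i)
      ≡⟨ trans (countFin≡∑ p) (∑-combine n m (bit ∘ p)) ⟩
    ∑[ c < n ] ∑[ l < m ] bit (p (combine c l))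
      ≡⟨ sum-cong-≗ (λ c → sum-cong-≗ (split c)) ⟩
    ∑[ c < n ] ∑[ l < m ] (W′ c l + V′ c l)
      ≡⟨ trans (sum-cong-≗ (λ c → ∑-distrib-+ (W′ c) (V′ c)))
               (∑-distrib-+ (λ c → ∑[ l < m ] W′ c l) (λ c → ∑[ l < m ] V′ c l)) ⟩
    (∑[ c < n ] ∑[ l < m ] W′ c l) + (∑[ c < n ] ∑[ l < m ] V′ c l)
      ≡⟨ cong₂ _+_ (sum-cong-≗ (λ c → ∑-feq i (W c)))
                   (trans (∑-comm V′) (sum-cong-≗ (λ l → ∑-feq a (λ c → V c l)))) ⟩
    (∑[ c < n ] bit (W c i)) + (∑[ l < m ] bit (V a l))
      ≡⟨ sym (cong₂ _+_ (countFin≡∑ (λ c → W c i)) (countFin≡∑ (V a))) ⟩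
    countFin (λ c → W c i) + countFin (V a) ∎
    where
    open ≡-Reasoning
    p : Fin (n * m) → Bool
    p u = adj (G □ K) (combine a i) u ∧ ⟦ X ⟧ (combine a i) u
    Z : Fin n → Fin m → Bool
    Z c l = ⟦ X ⟧ (combine a i) (combine c l)
    W V : Fin n → Fin m → Bool
    W c l = adj G a c ∧ Z c l
    V c l = adj K i l ∧ Z c l
    W′ V′ : Fin n → Fin m → ℕ
    W′ c l = bit (feq i l ∧ W c l)
    V′ c l = bit (feq a c ∧ V c l)
    split : ∀ c l → bit (adj (G □ K) (combine a i) (combine c l) ∧ Z c l) ≡ W′ c l + V′ c l
    split c l = trans (cong (λ b → bit (b ∧ Z c l)) (adj-□ a i c l))
      (bit-pairAdj (adj G a c) (feq i l) (feq a c) (adj K i l) (Z c l)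
        (λ _ a≡c → subst (λ c → adj G a c ≡ false) (feq-sound a≡c) (irrefl G a)))

layer : ∀ {n m} → Fin m → Fin n → Fin (n * m)
layer i a = combine a i

module _ {n} (G : Graph n) (k : ℕ) where

  layerDeg : EdgeSet (n * suc k) → Fin (suc k) → Fin n → ℕ
  layerDeg X i a = countFin (λ c → adj G a c ∧ ⟦ X ⟧ (layer i a) (layer i c))

  infDeg-centre : ∀ X a → infDeg (G □ Star k) X (layer zero a) ≡
    layerDeg X zero a + countFin (λ j → ⟦ X ⟧ (layer zero a) (layer (suc j) a))
  infDeg-centre X a = infDeg-□ G (Star k) X a zero

  infDeg-leaf : ∀ X j a → infDeg (G □ Star k) X (layer (suc j) a) ≡
    layerDeg X (suc j) a + bit (⟦ X ⟧ (layer (suc j) a) (layer zero a))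
  infDeg-leaf X j a = trans (infDeg-□ G (Star k) X a (suc j))
    (cong (layerDeg X (suc j) a +_) (trans (cong (bit star +_) (countFin-false k)) (+-identityʳ _)))
    where star = ⟦ X ⟧ (layer (suc j) a) (layer zero a)

  layerDeg≤infDeg : ∀ X i a → layerDeg X i a ≤ infDeg (G □ Star k) X (layer i a)
  layerDeg≤infDeg X i a = subst (layerDeg X i a ≤_) (sym (infDeg-□ G (Star k) X a i)) (m≤m+n _ _)

  layerDeg-⊑ : ∀ {Y} X i a → Y ⊑⟨ layer i ⟩ X → infDeg G Y a ≤ layerDeg X i a
  layerDeg-⊑ X i a Y⊑X = countFin-mono λ c h →
    let (e , y) = ∧-true (adj G a c) h in ∧-intro e (Y⊑X a c y)

-- The seed in G □ S_k

module Seed {n} (G : Graph n) (k r : ℕ) (S₁ S₀ : EdgeSet n) where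

  H : Graph (n * suc k)
  H = G □ Star k

  deficit : Fin n → ℕ
  deficit a = r ∸ deg G a

  seedPair : Fin n × Fin (suc k) → Fin n × Fin (suc k) → Bool
  seedPair (a , zero)  (c , zero)  = ⟦ S₁ ⟧ a c
  seedPair (a , suc i) (c , suc l) = feq i l ∧ ⟦ S₀ ⟧ a c
  seedPair (a , zero)  (c , suc l) = feq a c ∧ (toℕ l <ᵇ deficit a)
  seedPair (a , suc i) (c , zero)  = feq a c ∧ (toℕ i <ᵇ deficit a)

  star-sym : ∀ a c (l : Fin k) → feq a c ∧ (toℕ l <ᵇ deficit a) ≡ feq c a ∧ (toℕ l <ᵇ deficit c)
  star-sym a c l with feq a c in e
  ... | true  with refl ← feq-sound {a = a} {c} e rewrite feq-refl a = refl
  ... | false rewrite feq-sym c a | e = refl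

  seedPair-sym : ∀ p q → seedPair p q ≡ seedPair q p
  seedPair-sym (a , zero)  (c , zero)  = ⟦⟧-sym S₁ a c
  seedPair-sym (a , suc i) (c , suc l) = cong₂ _∧_ (feq-sym i l) (⟦⟧-sym S₀ a c)
  seedPair-sym (a , zero)  (c , suc l) = star-sym a c l
  seedPair-sym (a , suc i) (c , zero)  = sym (seedPair-sym (c , zero) (a , suc i))

  seed : EdgeSet (n * suc k)
  seed u v = seedPair (remQuot {n} (suc k) u) (remQuot {n} (suc k) v)

  ⟦seed⟧ : ∀ a i c l → ⟦ seed ⟧ (layer i a) (layer l c) ≡ seedPair (a , i) (c , l)
  ⟦seed⟧ a i c l =
    trans (⟦⟧-of-symmetric seed (λ u v → seedPair-sym (remQuot {n} (suc k) u) (remQuot {n} (suc k) v))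
                           (layer i a) (layer l c))
          (cong₂ seedPair (remQuot-combine a i) (remQuot-combine c l))

  ⟦seed⟧-centre : ∀ a c → ⟦ seed ⟧ (layer zero a) (layer zero c) ≡ ⟦ S₁ ⟧ a c
  ⟦seed⟧-centre a c = ⟦seed⟧ a zero c zero

  ⟦seed⟧-leaf : ∀ j a c → ⟦ seed ⟧ (layer (suc j) a) (layer (suc j) c) ≡ ⟦ S₀ ⟧ a c
  ⟦seed⟧-leaf j a c = trans (⟦seed⟧ a (suc j) c (suc j)) (cong (_∧ ⟦ S₀ ⟧ a c) (feq-refl j))

  ⟦seed⟧-star : ∀ a j → ⟦ seed ⟧ (layer zero a) (layer (suc j) a) ≡ (toℕ j <ᵇ deficit a)
  ⟦seed⟧-star a j = trans (⟦seed⟧ a zero a (suc j)) (cong (_∧ (toℕ j <ᵇ deficit a)) (feq-refl a))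

  S₁⊑seed : S₁ ⊑⟨ layer zero ⟩ seed
  S₁⊑seed a c = trans (⟦seed⟧-centre a c)

  S₀⊑seed : ∀ j → S₀ ⊑⟨ layer (suc j) ⟩ seed
  S₀⊑seed j a c = trans (⟦seed⟧-leaf j a c)

  infDeg-seed-centre : ∀ a → infDeg H seed (layer zero a) ≡ infDeg G S₁ a + deficit a ⊓ k
  infDeg-seed-centre a = trans (infDeg-centre G k seed a) (cong₂ _+_
    (countFin-cong (λ c → cong (adj G a c ∧_) (⟦seed⟧-centre a c)))
    (trans (countFin-cong (⟦seed⟧-star a)) (countFin-toℕ<ᵇ k (deficit a))))

  infDeg-seed-leaf : ∀ j a →
    infDeg H seed (layer (suc j) a) ≡ infDeg G S₀ a + bit (toℕ j <ᵇ deficit a)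
  infDeg-seed-leaf j a = trans (infDeg-leaf G k seed j a) (cong₂ _+_
    (countFin-cong (λ c → cong (adj G a c ∧_) (⟦seed⟧-leaf j a c)))
    (cong bit (trans (⟦⟧-sym seed _ _) (⟦seed⟧-star a j))))

  seed-size : size H seed ≡ size G S₁ + k * size G S₀ + ∑[ a < n ] (deficit a ⊓ k)
  seed-size = *-cancelˡ-≡ _ _ 2 (begin
    2 * size H seed
      ≡⟨ sym (handshake H seed) ⟩
    ∑ (infDeg H seed)
      ≡⟨ ∑-combine n (suc k) (infDeg H seed) ⟩
    ∑[ a < n ] ∑[ i < suc k ] infDeg H seed (layer i a)
      ≡⟨ sum-cong-≗ (λ a → cong₂ _+_ (infDeg-seed-centre a) (leaves a)) ⟩
    ∑[ a < n ] (d₁ a + M a + (k * d₀ a + M a))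
      ≡⟨ trans (∑-distrib-+ (λ a → d₁ a + M a) (λ a → k * d₀ a + M a))
               (cong₂ _+_ (∑-distrib-+ d₁ M)
                          (trans (∑-distrib-+ (λ a → k * d₀ a) M)
                                 (cong (_+ ∑ M) (sym (*-distribˡ-sum k d₀))))) ⟩
    ∑ d₁ + ∑ M + (k * ∑ d₀ + ∑ M)
      ≡⟨ cong₂ (λ x y → x + ∑ M + (k * y + ∑ M)) (handshake G S₁) (handshake G S₀) ⟩
    2 * size G S₁ + ∑ M + (k * (2 * size G S₀) + ∑ M)
      ≡⟨ double (size G S₁) (size G S₀) (∑ M) k ⟩
    2 * (size G S₁ + k * size G S₀ + ∑ M) ∎)
    where
    open ≡-Reasoning
    d₁ d₀ M : Fin n → ℕ
    d₁ = infDeg G S₁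
    d₀ = infDeg G S₀
    M a = deficit a ⊓ k
    leaves : ∀ a → ∑[ j < k ] infDeg H seed (layer (suc j) a) ≡ k * d₀ a + M a
    leaves a = begin
      ∑[ j < k ] infDeg H seed (layer (suc j) a)
        ≡⟨ sum-cong-≗ (λ j → infDeg-seed-leaf j a) ⟩
      ∑[ j < k ] (d₀ a + bit (toℕ j <ᵇ deficit a))
        ≡⟨ ∑-distrib-+ {k} (λ _ → d₀ a) (λ j → bit (toℕ j <ᵇ deficit a)) ⟩
      (∑[ j < k ] d₀ a) + (∑[ j < k ] bit (toℕ j <ᵇ deficit a))
        ≡⟨ cong₂ _+_ (∑-const k (d₀ a))
                     (trans (sym (countFin≡∑ {k} (λ j → toℕ j <ᵇ deficit a))) (countFin-toℕ<ᵇ k (deficit a))) ⟩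
      k * d₀ a + M a ∎
    double : ∀ x y z k → 2 * x + z + (k * (2 * y) + z) ≡ 2 * (x + k * y + z)
    double = solve-∀

  module Percolation
    (t₁ : ℕ) (full₁ : ∀ a c → adj G a c ≡ true → ⟦ iter G r t₁ S₁ ⟧ a c ≡ true)
    (t₀ : ℕ) (full₀ : ∀ a c → adj G a c ≡ true → ⟦ iter G (r ∸ 1) t₀ S₀ ⟧ a c ≡ true) where

    X₁ X₂ : EdgeSet (n * suc k)
    X₁ = iter H r t₁ seed
    X₂ = step H r X₁

    centre-layer : ∀ a c → adj G a c ≡ true → ⟦ X₁ ⟧ (layer zero a) (layer zero c) ≡ true
    centre-layer a c e =
      simulate (layer zero) (adj-□-layer G (Star k) zero) active S₁⊑seed t₁ a c (full₁ a c e)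
      where
      active : ∀ s {Y} → Y ⊑⟨ layer zero ⟩ iter H r s seed → ∀ a → r ≤ infDeg G Y a →
               r ≤ infDeg H (iter H r s seed) (layer zero a)
      active s Y⊑X a r≤ =
        ≤-trans r≤ (≤-trans (layerDeg-⊑ G k X zero a Y⊑X) (layerDeg≤infDeg G k X zero a))
        where X = iter H r s seed

    star-edge : ∀ a j → ⟦ X₂ ⟧ (layer zero a) (layer (suc j) a) ≡ true
    star-edge a j with toℕ j <ᵇ deficit a in j<deficit
    ... | true  = ⊆-step H r X₁ _ _ (⊆-iter H r t₁ seed _ _ (trans (⟦seed⟧-star a j) j<deficit))
    ... | false = step-intro H r X₁ _ _ (adj-□-fibre G (Star k) a refl) (inj₁ (begin
      r                       ≤⟨ m≤n+m∸n r (deg G a) ⟩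
      deg G a + deficit a     ≡⟨ cong (deg G a +_) (sym (m≤n⇒m⊓n≡m deficit≤k)) ⟩
      deg G a + deficit a ⊓ k ≡⟨ cong (deg G a +_) (sym (countFin-toℕ<ᵇ k (deficit a))) ⟩
      deg G a + countFin {k} (λ j′ → toℕ j′ <ᵇ deficit a)
        ≤⟨ +-mono-≤ (countFin-mono λ c e → ∧-intro e (centre-layer a c e))
                    (countFin-mono λ j′ h → ⊆-iter H r t₁ seed _ _ (trans (⟦seed⟧-star a j′) h)) ⟩
      layerDeg G k X₁ zero a + countFin (λ j′ → ⟦ X₁ ⟧ (layer zero a) (layer (suc j′) a))
        ≡⟨ sym (infDeg-centre G k X₁ a) ⟩
      infDeg H X₁ (layer zero a) ∎))
      where
      open ≤-Reasoning
      deficit≤k : deficit a ≤ k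
      deficit≤k = ≤-trans (<ᵇ-false-elim j<deficit) (<⇒≤ (toℕ<n j))

    leaf-layer : ∀ j a c → adj G a c ≡ true →
      ⟦ iter H r t₀ X₂ ⟧ (layer (suc j) a) (layer (suc j) c) ≡ true
    leaf-layer j a c e =
      simulate (layer (suc j)) (adj-□-layer G (Star k) (suc j)) active S₀⊑X₂ t₀ a c (full₀ a c e)
      where
      S₀⊑X₂ : S₀ ⊑⟨ layer (suc j) ⟩ X₂
      S₀⊑X₂ a c h = ⊆-step H r X₁ _ _ (⊆-iter H r t₁ seed _ _ (S₀⊑seed j a c h))
      active : ∀ s {Y} → Y ⊑⟨ layer (suc j) ⟩ iter H r s X₂ → ∀ a → r ∸ 1 ≤ infDeg G Y a →
               r ≤ infDeg H (iter H r s X₂) (layer (suc j) a)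
      active s {Y} Y⊑X a r∸1≤ = begin
        r                                              ≤⟨ m≤n+m∸n r 1 ⟩
        suc (r ∸ 1)                                    ≤⟨ s≤s r∸1≤ ⟩
        suc (infDeg G Y a)                             ≤⟨ s≤s (layerDeg-⊑ G k X (suc j) a Y⊑X) ⟩
        suc (layerDeg G k X (suc j) a)                 ≡⟨ +-comm 1 _ ⟩
        layerDeg G k X (suc j) a + 1
          ≡⟨ cong (λ b → layerDeg G k X (suc j) a + bit b) (sym star) ⟩
        layerDeg G k X (suc j) a + bit (⟦ X ⟧ (layer (suc j) a) (layer zero a))
          ≡⟨ sym (infDeg-leaf G k X j a) ⟩
        infDeg H X (layer (suc j) a) ∎
        where
        open ≤-Reasoning
        X = iter H r s X₂
        star : ⟦ X ⟧ (layer (suc j) a) (layer zero a) ≡ true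
        star = trans (⟦⟧-sym X _ _) (⊆-iter H r s X₂ _ _ (star-edge a j))

    every-edge : ∀ u v → adj H u v ≡ true → ⟦ iter H r t₀ X₂ ⟧ u v ≡ true
    every-edge = ∀-combine edge
      where
      edge : ∀ a i c l → adj H (layer i a) (layer l c) ≡ true →
             ⟦ iter H r t₀ X₂ ⟧ (layer i a) (layer l c) ≡ true
      edge a i c l e with adj-□-elim G (Star k) a i c l e
      edge a zero    c _       _ | inj₁ (ac , refl) =
        ⊆-iter H r t₀ X₂ _ _ (⊆-step H r X₁ _ _ (centre-layer a c ac))
      edge a (suc j) c _       _ | inj₁ (ac , refl) = leaf-layer j a c ac
      edge a zero    _ (suc j) _ | inj₂ (refl , _)  = ⊆-iter H r t₀ X₂ _ _ (star-edge a j)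
      edge a (suc j) _ zero    _ | inj₂ (refl , _)  =
        trans (⟦⟧-sym (iter H r t₀ X₂) _ _) (⊆-iter H r t₀ X₂ _ _ (star-edge a j))
      edge a zero    _ zero    _ | inj₂ (refl , ())
      edge a (suc _) _ (suc _) _ | inj₂ (refl , ())

  seed-percolates : Percolating G r S₁ → Percolating G (r ∸ 1) S₀ → Percolating H r seed
  seed-percolates (t₁ , full₁) (t₀ , full₀) =
    t₀ + suc t₁ , λ u v e →
      subst (λ X → ⟦ X ⟧ u v ≡ true) (iter-+ H r t₀ (suc t₁) seed) (every-edge u v e)
    where open Percolation t₁ full₁ t₀ full₀

-- Grouping vertices by degree

≤-sum-map : ∀ (g : ℕ → ℕ) {x xs} → x ∈ xs → g x ≤ sum (map g xs)
≤-sum-map g (here refl)           = m≤m+n _ _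
≤-sum-map g {xs = y ∷ _} (there p) = ≤-trans (≤-sum-map g p) (m≤n+m _ (g y))

≤-sumFromTo : ∀ {a b t} (f : ℕ → ℕ) → a ≤ t → t ≤ b → f t ≤ sumFromTo a b f
≤-sumFromTo {a} {b} {t} f a≤t t≤b =
  subst (λ x → f x ≤ sumFromTo a b f) (m+[n∸m]≡n a≤t) (≤-sum-map (λ i → f (a + i)) (∈-upTo⁺ t∸a<))
  where
  t∸a< : t ∸ a < suc b ∸ a
  t∸a< = subst (_≤ suc b ∸ a) (+-∸-assoc 1 a≤t) (∸-monoˡ-≤ a (s≤s t≤b))

∑-sum-map : ∀ {n} (h : Fin n → ℕ → ℕ) xs →
  ∑[ v < n ] sum (map (h v) xs) ≡ sum (map (λ x → ∑[ v < n ] h v x) xs)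
∑-sum-map {n} h []       = sum-replicate-zero n
∑-sum-map {n} h (x ∷ xs) = trans (∑-distrib-+ (λ v → h v x) (λ v → sum (map (h v) xs)))
                                 (cong (∑[ v < n ] h v x +_) (∑-sum-map h xs))

∑-sumFromTo : ∀ {n} a b (h : Fin n → ℕ → ℕ) →
  ∑[ v < n ] sumFromTo a b (h v) ≡ sumFromTo a b (λ t → ∑[ v < n ] h v t)
∑-sumFromTo a b h = ∑-sum-map (λ v i → h v (a + i)) (upTo (suc b ∸ a))

sumFromTo-cong : ∀ a b {f g : ℕ → ℕ} → (∀ t → f t ≡ g t) →
  sumFromTo a b f ≡ sumFromTo a b g
sumFromTo-cong a b f≗g = cong sum (map-cong (λ i → f≗g (a + i)) (upTo (suc b ∸ a)))

-- The contribution of a vertex of degree D to d^G_{r-t}.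
hasDeficit : ℕ → ℕ → ℕ → ℕ
hasDeficit r D t = bit ((t ≤ᵇ r) ∧ (D ≡ᵇ r ∸ t))

dDiff≡∑hasDeficit : ∀ {n} (G : Graph n) r t → dDiff G r t ≡ ∑[ a < n ] hasDeficit r (deg G a) t
dDiff≡∑hasDeficit {n} G r t with t ≤ᵇ r
... | true  = countFin≡∑ (λ a → deg G a ≡ᵇ r ∸ t)
... | false = sym (sum-replicate-zero n)

hasDeficit-self : ∀ {r D} → D ≤ r → hasDeficit r D (r ∸ D) ≡ 1
hasDeficit-self {r} {D} D≤r rewrite ≤ᵇ-intro (m∸n≤m r D) | m∸[m∸n]≡n D≤r =
  cong bit (Equivalence.to T-≡ (≡⇒≡ᵇ D D refl))

⊓≤sumFromTo : ∀ {r k t} (δ : ℕ → ℕ) → δ t ≡ 1 → 1 ≤ t → t ≤ r →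
  t ⊓ k ≤ sumFromTo 1 (k ∸ 1) (λ s → s * δ s) + k * sumFromTo k r δ
⊓≤sumFromTo {r} {k} {t} δ δt≡1 1≤t t≤r with t <? k
... | yes t<k = begin
  t ⊓ k                                 ≤⟨ m⊓n≤m t k ⟩
  t                                     ≡⟨ sym (*-identityʳ t) ⟩
  t * 1                                 ≡⟨ cong (t *_) (sym δt≡1) ⟩
  t * δ t                               ≤⟨ ≤-sumFromTo (λ s → s * δ s) 1≤t (<⇒≤∸1 t<k) ⟩
  sumFromTo 1 (k ∸ 1) (λ s → s * δ s)   ≤⟨ m≤m+n _ _ ⟩
  _                                     ∎
  where
  open ≤-Reasoning
  <⇒≤∸1 : ∀ {m n} → m < n → m ≤ n ∸ 1
  <⇒≤∸1 (s≤s m≤n) = m≤n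
... | no t≮k = begin
  t ⊓ k                                 ≤⟨ m⊓n≤n t k ⟩
  k                                     ≡⟨ sym (*-identityʳ k) ⟩
  k * 1                                 ≡⟨ cong (k *_) (sym δt≡1) ⟩
  k * δ t                               ≤⟨ *-monoʳ-≤ k (≤-sumFromTo δ (≮⇒≥ t≮k) t≤r) ⟩
  k * sumFromTo k r δ                   ≤⟨ m≤n+m _ _ ⟩
  _                                     ∎
  where open ≤-Reasoning

deficit⊓k≤ : ∀ r k D → (r ∸ D) ⊓ k ≤
  sumFromTo 1 (k ∸ 1) (λ t → t * hasDeficit r D t) + k * sumFromTo k r (hasDeficit r D)
deficit⊓k≤ r k D with r ≤? D
... | yes r≤D rewrite m≤n⇒m∸n≡0 r≤D = z≤n
... | no  r≰D = ⊓≤sumFromTo (hasDeficit r D) (hasDeficit-self (<⇒≤ D<r)) (m<n⇒0<n∸m D<r) (m∸n≤m r D)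
  where D<r = ≰⇒> r≰D

∑-deficit⊓k≤ : ∀ {n} (G : Graph n) k r → ∑[ a < n ] ((r ∸ deg G a) ⊓ k) ≤
  sumFromTo 1 (k ∸ 1) (λ t → t * dDiff G r t) + k * sumFromTo k r (λ t → dDiff G r t)
∑-deficit⊓k≤ {n} G k r = begin
  ∑[ a < n ] ((r ∸ deg G a) ⊓ k)
    ≤⟨ ∑-mono-≤ (λ a → deficit⊓k≤ r k (deg G a)) ⟩
  ∑[ a < n ] (sumFromTo 1 (k ∸ 1) (λ t → t * δ a t) + k * sumFromTo k r (δ a))
    ≡⟨ trans (∑-distrib-+ (λ a → sumFromTo 1 (k ∸ 1) (λ t → t * δ a t)) (λ a → k * sumFromTo k r (δ a)))
             (cong ((∑[ a < n ] sumFromTo 1 (k ∸ 1) (λ t → t * δ a t)) +_)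
                   (sym (*-distribˡ-sum k (λ a → sumFromTo k r (δ a))))) ⟩
  (∑[ a < n ] sumFromTo 1 (k ∸ 1) (λ t → t * δ a t)) + k * (∑[ a < n ] sumFromTo k r (δ a))
    ≡⟨ cong₂ (λ x y → x + k * y) (∑-sumFromTo 1 (k ∸ 1) (λ a t → t * δ a t)) (∑-sumFromTo k r δ) ⟩
  sumFromTo 1 (k ∸ 1) (λ t → ∑[ a < n ] (t * δ a t)) + k * sumFromTo k r (λ t → ∑[ a < n ] δ a t)
    ≡⟨ cong₂ (λ x y → x + k * y)
         (sumFromTo-cong 1 (k ∸ 1) (λ t → trans (sym (*-distribˡ-sum t (λ a → δ a t)))
                                                (cong (t *_) (sym (dDiff≡∑hasDeficit G r t)))))
         (sumFromTo-cong k r (λ t → sym (dDiff≡∑hasDeficit G r t))) ⟩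
  sumFromTo 1 (k ∸ 1) (λ t → t * dDiff G r t) + k * sumFromTo k r (λ t → dDiff G r t) ∎
  where
  open ≤-Reasoning
  δ : Fin n → ℕ → ℕ
  δ a = hasDeficit r (deg G a)

proposition3p6 : ∀ (r k : ℕ) → 1 ≤ r → 1 ≤ k → ∀ {n} (G : Graph n) →
    ∀ (mProd m₁ m₀ : ℕ) →
    IsMe (G □ Star k) r mProd → IsMe G r m₁ → IsMe G (r ∸ 1) m₀ →
    mProd ≤ m₁ + k * m₀
            + sumFromTo 1 (k ∸ 1) (λ t → t * dDiff G r t)
            + k * sumFromTo k r (λ t → dDiff G r t)
proposition3p6 r k _ _ {n} G mProd _ _ (_ , minimal) ((S₁ , perc₁ , refl) , _) ((S₀ , perc₀ , refl) , _) =
  begin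
  mProd                                                  ≤⟨ minimal seed (seed-percolates perc₁ perc₀) ⟩
  size (G □ Star k) seed                                 ≡⟨ seed-size ⟩
  size G S₁ + k * size G S₀ + ∑[ a < n ] (deficit a ⊓ k) ≤⟨ +-monoʳ-≤ _ (∑-deficit⊓k≤ G k r) ⟩
  size G S₁ + k * size G S₀ + (A + k * B)                ≡⟨ sym (+-assoc _ A (k * B)) ⟩
  size G S₁ + k * size G S₀ + A + k * B                  ∎
  where
  open ≤-Reasoning
  open Seed G k r S₁ S₀
  A = sumFromTo 1 (k ∸ 1) (λ t → t * dDiff G r t)
  B = sumFromTo k r (λ t → dDiff G r t)
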